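{- Let $b,c,d$ be integers with $c>0$, $b\equiv 2\pmod 4$, $d=b^2+c^2$ squarefree and $d\equiv 5\pmod 8$. Let $C,D$ be integers such that $$p=\frac{1}{16}\left(\left(\frac b2C^2+cCD-\frac b2D^2\right)^2+dC^2+dD^2+d\right)\quad\text{and}\quad I=\frac14\left|cC^2-2bCD-cD^2\right|$$ are integers. If $3\mid c$, then $3\mid pI$. -}

module Defs where

open import Data.Integer using (ℤ; +_; _*_; ∣_∣)
open import Data.Integer.Divisibility using (_∣_)
open import Relation.Binary.PropositionalEquality using (_≡_)

SquareFree : ℤ → Set
SquareFree d = ∀ (n : ℤ) → (n * n) ∣ d → ∣ n ∣ ≡ 1

_≡_[mod_] : ℤ → ℤ → ℤ → Set
x ≡ a [mod m ] = m ∣ (x Data.Integer.- a)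

{-# OPTIONS --safe #-}
-- Work modulo 3, where c ≡ 0.  If 3 divides C or D, it divides every term of
-- cC² − 2bCD − cD², hence 4I and I.  Otherwise C² ≡ D² ≡ 1, so
-- hC² + cCD − hD² = h(C² − D²) + cCD ≡ 0 and C² + D² + 1 ≡ 0; then 3 divides
-- every term of 16p.
module Submission where

open import Defs
open import Data.Integer using (ℤ; +_; _+_; _-_; _*_; _>_; ∣_∣)
open import Data.Integer.Divisibility using (_∣_)
open import Relation.Binary.PropositionalEquality using (_≡_)

open import Data.Integer using (_%_; _/_)
open import Data.Integer.DivMod using (a≡a%n+[a/n]*n; n%d<d)
open import Data.Integer.Divisibility.Signed as Signed
  using (divides; ∣ᵤ⇒∣; ∣⇒∣ᵤ; ∣-trans; m∣∣m∣; ∣m∣n⇒∣m+n; ∣m∣n⇒∣m-n; ∣m+n∣n⇒∣m; ∣n⇒∣m*n; ∣m⇒∣m*n; ∣-refl)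
open import Data.Integer.Tactic.RingSolver using (solve-∀)
open import Data.Nat using (suc; _<_; s≤s)
open import Data.Sum using (_⊎_; inj₁; inj₂; [_,_]; map₂)
open import Function using (_∘_)
open import Relation.Binary.PropositionalEquality using (sym; subst)

3∣n⊎3∣n-1⊎3∣n+1 : ∀ n → (+ 3 Signed.∣ n) ⊎ (+ 3 Signed.∣ n - + 1) ⊎ (+ 3 Signed.∣ n + + 1)
3∣n⊎3∣n-1⊎3∣n+1 n = subst Residue (sym (a≡a%n+[a/n]*n n (+ 3))) (residue (n % + 3) (n / + 3) (n%d<d n (+ 3)))
  where
  Residue : ℤ → Set
  Residue m = (+ 3 Signed.∣ m) ⊎ (+ 3 Signed.∣ m - + 1) ⊎ (+ 3 Signed.∣ m + + 1)

  shift₀ : ∀ q → + 0 + q * + 3 ≡ q * + 3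
  shift₀ = solve-∀
  shift₁ : ∀ q → (+ 1 + q * + 3) - + 1 ≡ q * + 3
  shift₁ = solve-∀
  shift₂ : ∀ q → (+ 2 + q * + 3) + + 1 ≡ (q + + 1) * + 3
  shift₂ = solve-∀

  residue : ∀ r q → r < 3 → Residue (+ r + q * + 3)
  residue 0 q _ = inj₁ (divides q (shift₀ q))
  residue 1 q _ = inj₂ (inj₁ (divides q (shift₁ q)))
  residue 2 q _ = inj₂ (inj₂ (divides (q + + 1) (shift₂ q)))
  residue (suc (suc (suc _))) _ (s≤s (s≤s (s≤s ())))

3∣n⊎3∣n*n-1 : ∀ n → (+ 3 Signed.∣ n) ⊎ (+ 3 Signed.∣ n * n - + 1)
3∣n⊎3∣n*n-1 n =
  map₂ (subst (+ 3 Signed.∣_) (sym (n*n-1≡[n-1]*[n+1] n)) ∘ [ ∣m⇒∣m*n (n + + 1) , ∣n⇒∣m*n (n - + 1) ])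
       (3∣n⊎3∣n-1⊎3∣n+1 n)
  where n*n-1≡[n-1]*[n+1] : ∀ n → n * n - + 1 ≡ (n - + 1) * (n + + 1)
        n*n-1≡[n-1]*[n+1] = solve-∀

∣[1+k*i]*n⇒∣n : ∀ i k n → i Signed.∣ (+ 1 + k * i) * n → i Signed.∣ n
∣[1+k*i]*n⇒∣n i k n i∣m = ∣m+n∣n⇒∣m (subst (i Signed.∣_) (expand i k n) i∣m) (∣m⇒∣m*n (k * n) ∣-refl)
  where expand : ∀ i k n → (+ 1 + k * i) * n ≡ n + i * (k * n)
        expand = solve-∀

p-numerator : ℤ → ℤ → ℤ → ℤ → ℤ → ℤ
p-numerator h c d C D =
  (h * C * C + c * C * D - h * D * D) * (h * C * C + c * C * D - h * D * D) + d * C * C + d * D * D + d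

I-form : ℤ → ℤ → ℤ → ℤ → ℤ
I-form b c C D = c * C * C - + 2 * b * C * D - c * D * D

∣c∣C*D⇒∣I-form : ∀ {i} b c C D → i Signed.∣ c → i Signed.∣ C * D → i Signed.∣ I-form b c C D
∣c∣C*D⇒∣I-form {i} b c C D i∣c i∣CD =
  subst (i Signed.∣_) (sym (regroup b c C D)) (∣m∣n⇒∣m-n (∣m⇒∣m*n (C * C - D * D) i∣c) (∣n⇒∣m*n (+ 2 * b) i∣CD))
  where regroup : ∀ b c C D → c * C * C - + 2 * b * C * D - c * D * D ≡ c * (C * C - D * D) - + 2 * b * (C * D)
        regroup = solve-∀

∣c∣C²-D²∣C²+D²+1⇒∣p-numerator : ∀ {i} h c d C D →
  i Signed.∣ c → i Signed.∣ C * C - D * D → i Signed.∣ C * C + D * D + + 1 → i Signed.∣ p-numerator h c d C D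
∣c∣C²-D²∣C²+D²+1⇒∣p-numerator {i} h c d C D i∣c i∣C²-D² i∣C²+D²+1 =
  subst (i Signed.∣_) (sym (regroup h c d C D)) (∣m∣n⇒∣m+n (∣m⇒∣m*n A i∣A) (∣n⇒∣m*n d i∣C²+D²+1))
  where
  A : ℤ
  A = h * (C * C - D * D) + c * (C * D)
  i∣A : i Signed.∣ A
  i∣A = ∣m∣n⇒∣m+n (∣n⇒∣m*n h i∣C²-D²) (∣m⇒∣m*n (C * D) i∣c)
  regroup : ∀ h c d C D →
    (h * C * C + c * C * D - h * D * D) * (h * C * C + c * C * D - h * D * D) + d * C * C + d * D * D + d
      ≡ (h * (C * C - D * D) + c * (C * D)) * (h * (C * C - D * D) + c * (C * D)) + d * (C * C + D * D + + 1)
  regroup = solve-∀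

mainTheorem7 : ∀ (b c d C D : ℤ) →
    c > + 0 →
    b ≡ + 2 [mod + 4 ] →
    d ≡ b * b + c * c →
    SquareFree d →
    d ≡ + 5 [mod + 8 ] →
    ∀ (h p I : ℤ) →
    b ≡ + 2 * h →
    + 16 * p ≡ (h * C * C + c * C * D - h * D * D) * (h * C * C + c * C * D - h * D * D) + d * C * C + d * D * D + d →
    + 4 * I ≡ + ∣ c * C * C - + 2 * b * C * D - c * D * D ∣ →
    + 3 ∣ c →
    + 3 ∣ p * I
mainTheorem7 b c d C D _ _ _ _ _ h p I _ p≡ I≡ 3∣c = ∣⇒∣ᵤ (3∣pI (3∣n⊎3∣n*n-1 C) (3∣n⊎3∣n*n-1 D))
  where
  -- 4 = 1 + 1 · 3 and 16 = 1 + 5 · 3 hold by computation.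
  3∣I : + 3 Signed.∣ C * D → + 3 Signed.∣ I
  3∣I 3∣CD = ∣[1+k*i]*n⇒∣n (+ 3) (+ 1) I (subst (+ 3 Signed.∣_) (sym I≡)
    (∣-trans (∣c∣C*D⇒∣I-form b c C D (∣ᵤ⇒∣ 3∣c) 3∣CD) m∣∣m∣))

  3∣p : + 3 Signed.∣ C * C - + 1 → + 3 Signed.∣ D * D - + 1 → + 3 Signed.∣ p
  3∣p 3∣C²-1 3∣D²-1 = ∣[1+k*i]*n⇒∣n (+ 3) (+ 5) p (subst (+ 3 Signed.∣_) (sym p≡)
    (∣c∣C²-D²∣C²+D²+1⇒∣p-numerator h c d C D (∣ᵤ⇒∣ 3∣c)
      (subst (+ 3 Signed.∣_) ([C²-1]-[D²-1]≡C²-D² C D) (∣m∣n⇒∣m-n 3∣C²-1 3∣D²-1))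
      (subst (+ 3 Signed.∣_) ([C²-1]+[D²-1]+3≡C²+D²+1 C D) (∣m∣n⇒∣m+n (∣m∣n⇒∣m+n 3∣C²-1 3∣D²-1) ∣-refl))))
    where
    [C²-1]-[D²-1]≡C²-D² : ∀ C D → (C * C - + 1) - (D * D - + 1) ≡ C * C - D * D
    [C²-1]-[D²-1]≡C²-D² = solve-∀
    [C²-1]+[D²-1]+3≡C²+D²+1 : ∀ C D → (C * C - + 1) + (D * D - + 1) + + 3 ≡ C * C + D * D + + 1
    [C²-1]+[D²-1]+3≡C²+D²+1 = solve-∀

  3∣pI : (+ 3 Signed.∣ C) ⊎ (+ 3 Signed.∣ C * C - + 1) → (+ 3 Signed.∣ D) ⊎ (+ 3 Signed.∣ D * D - + 1) →
         + 3 Signed.∣ p * I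
  3∣pI (inj₁ 3∣C) _ = ∣n⇒∣m*n p (3∣I (∣m⇒∣m*n D 3∣C))
  3∣pI (inj₂ _) (inj₁ 3∣D) = ∣n⇒∣m*n p (3∣I (∣n⇒∣m*n C 3∣D))
  3∣pI (inj₂ 3∣C²-1) (inj₂ 3∣D²-1) = ∣m⇒∣m*n I (3∣p 3∣C²-1 3∣D²-1)
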